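{- Let $m,n\ge 3$ with $m\equiv 0\pmod{11}$ and $n\equiv 0\pmod{11}$, and let $T_{m,n}=C_m\Box C_n$. Then $\chi(T_{m,n}^2)\le 6$.
   Context: $C_j$ denotes the cycle on $j$ vertices; $\Box$ is the Cartesian product of graphs. The square $G^2$ of a graph $G$ has vertex set $V(G)$, two distinct vertices being adjacent iff their distance in $G$ is at most 2. $\chi$ is the chromatic number. -}

module Defs where

open import Data.Nat using (ℕ; suc; _+_; _%_; NonZero)
open import Data.Fin using (Fin; toℕ)
open import Data.Product using (_×_; Σ; _,_)
open import Data.Sum using (_⊎_)
open import Relation.Binary.PropositionalEquality using (_≡_; _≢_)
open import Relation.Nullary using (¬_)

-- Here we only need adjacency relations; simplicity of our concrete graphs
-- holds by construction (for j ≥ 3 in the cycle case).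
Graph : Set → Set₁
Graph V = V → V → Set

-- The cycle C_j on vertex set Fin j (= ℤ/jℤ): x ~ y iff y ≡ x+1 (mod j) or x ≡ y+1 (mod j).
-- For j ≥ 3 this is the usual j-cycle.
Cycle : (j : ℕ) → .{{_ : NonZero j}} → Graph (Fin j)
Cycle j x y = (toℕ y ≡ (toℕ x + 1) % j) ⊎ (toℕ x ≡ (toℕ y + 1) % j)

_□_ : {V W : Set} → Graph V → Graph W → Graph (V × W)
(G □ H) (a , b) (a' , b') = (G a a' × b ≡ b') ⊎ (a ≡ a' × H b b')

Square : {V : Set} → Graph V → Graph V
Square G u v = u ≢ v × (G u v ⊎ Σ _ (λ w → G u w × G w v))

ProperColouring : {V : Set} → Graph V → ℕ → Set
ProperColouring {V} G k = Σ (V → Fin k) (λ c → ∀ u v → G u v → c u ≢ c v)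

χ≤ : {V : Set} → Graph V → ℕ → Set
χ≤ G k = ProperColouring G k

module Submission where

-- Idea: reducing coordinates mod 11 maps the torus T_{m,n} = C_m □ C_n onto
-- T_{11,11}, and this covering map is injective on the neighbourhood of every
-- vertex.  Such a map sends distinct vertices at distance ≤ 2 to distinct
-- vertices at distance ≤ 2, so it is a homomorphism of squares, and any proper
-- colouring of T_{11,11}² pulls back to T_{m,n}².  It therefore suffices to
-- exhibit one 6-colouring of T_{11,11}², which is checked by computation.

open import Defs
open import Data.Nat using (ℕ; suc; _+_; _%_; _≤_; _<_; _≥_; s≤s; z≤n; NonZero)
open import Data.Nat.Properties using (suc-injective; m≤n⇒m<n∨m≡n; +-comm; 1+n≢n; 0≢1+n; m≢1+n+m; <⇒≤)
open import Data.Nat.DivMod using (m%n<n; m<n⇒m%n≡m; n%n≡0; %-distribˡ-+; m%n%n≡m%n; m∣n⇒o%n%m≡o%m)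
open import Data.Nat.Divisibility using (_∣_; m%n≡0⇒n∣m)
open import Data.Fin using (Fin; toℕ; fromℕ<; _≟_)
open import Data.Fin.Properties using (toℕ-fromℕ<; toℕ-injective; toℕ<n; all?)
import Data.Fin.Literals as Fin
open import Data.Vec using (Vec; _∷_; []; lookup)
open import Data.Product using (_×_; _,_)
open import Data.Product.Properties using (,-injectiveˡ; ,-injectiveʳ)
open import Data.Sum using (_⊎_; inj₁; inj₂)
open import Data.Empty using (⊥-elim)
open import Data.Unit using (⊤; tt)
open import Function using (_∘_)
open import Agda.Builtin.FromNat using (Number)
open import Relation.Nullary using (¬_; Dec)
open import Relation.Nullary.Decidable using (toWitness; map′; ¬?; _×-dec_)
open import Relation.Binary.PropositionalEquality
  using (_≡_; _≢_; refl; sym; trans; cong; subst; ≢-sym; module ≡-Reasoning)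

Homomorphism : {V W : Set} → Graph V → Graph W → (V → W) → Set
Homomorphism G H f = ∀ {u v} → G u v → H (f u) (f v)

Loopless : {V : Set} → Graph V → Set
Loopless G = ∀ {u} → ¬ G u u

adjacent⇒distinct : {V : Set} (G : Graph V) → Loopless G → ∀ {u v} → G u v → u ≢ v
adjacent⇒distinct G loopless e refl = loopless e

LocallyInjective : {V W : Set} → Graph V → (V → W) → Set
LocallyInjective G f = ∀ {u w v} → G u w → G w v → f u ≡ f v → u ≡ v

module _ {V W : Set} {G : Graph V} {H : Graph W} {f : V → W} where

  square-homomorphism : Homomorphism G H f → Loopless H → LocallyInjective G f →
                        Homomorphism (Square G) (Square H) f
  square-homomorphism hom loopless _ (_ , inj₁ e) =
    adjacent⇒distinct H loopless (hom e) , inj₁ (hom e)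
  square-homomorphism hom loopless locInj (u≢v , inj₂ (w , e₁ , e₂)) =
    (λ fu≡fv → u≢v (locInj e₁ e₂ fu≡fv)) , inj₂ (f w , hom e₁ , hom e₂)

  pullback : ∀ {q} → Homomorphism G H f → ProperColouring H q → ProperColouring G q
  pullback hom (c , proper) = c ∘ f , λ u v e → proper (f u) (f v) (hom e)

_⊗_ : {V V′ W W′ : Set} → (V → W) → (V′ → W′) → V × V′ → W × W′
(g ⊗ g′) (x , x′) = g x , g′ x′

module _ {V V′ W W′ : Set} {G : Graph V} {G′ : Graph V′} {H : Graph W} {H′ : Graph W′}
         {f : V → W} {f′ : V′ → W′} where

  □-homomorphism : Homomorphism G H f → Homomorphism G′ H′ f′ →
                   Homomorphism (G □ G′) (H □ H′) (f ⊗ f′)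
  □-homomorphism hom hom′ (inj₁ (e , refl)) = inj₁ (hom e , refl)
  □-homomorphism hom hom′ (inj₂ (refl , e)) = inj₂ (refl , hom′ e)

  -- A walk of length two in G □ G′ either stays in one factor, where local
  -- injectivity applies, or turns a corner, in which case its ends differ in
  -- both coordinates and an identification would create a loop in H or H′.
  □-locallyInjective : Homomorphism G H f → Homomorphism G′ H′ f′ → Loopless H → Loopless H′ →
                       LocallyInjective G f → LocallyInjective G′ f′ →
                       LocallyInjective (G □ G′) (f ⊗ f′)
  □-locallyInjective hom hom′ loopless loopless′ locInj locInj′ = walk
    where
    walk : LocallyInjective (G □ G′) (f ⊗ f′)
    walk (inj₁ (e₁ , refl)) (inj₁ (e₂ , refl)) eq = cong (_, _) (locInj e₁ e₂ (,-injectiveˡ eq))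
    walk (inj₂ (refl , e₁)) (inj₂ (refl , e₂)) eq = cong (_ ,_) (locInj′ e₁ e₂ (,-injectiveʳ eq))
    walk (inj₁ (e₁ , refl)) (inj₂ (refl , e₂)) eq =
      ⊥-elim (adjacent⇒distinct H loopless (hom e₁) (,-injectiveˡ eq))
    walk (inj₂ (refl , e₁)) (inj₁ (e₂ , refl)) eq =
      ⊥-elim (adjacent⇒distinct H′ loopless′ (hom′ e₁) (,-injectiveʳ eq))

□-loopless : {V V′ : Set} {G : Graph V} {G′ : Graph V′} →
             Loopless G → Loopless G′ → Loopless (G □ G′)
□-loopless loopless loopless′ (inj₁ (e , _)) = loopless e
□-loopless loopless loopless′ (inj₂ (_ , e)) = loopless′ e

+1-mod : ∀ k .{{_ : NonZero k}} {z} → z < k →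
         (suc z < k × (z + 1) % k ≡ suc z) ⊎ (suc z ≡ k × (z + 1) % k ≡ 0)
+1-mod k {z} z<k with m≤n⇒m<n∨m≡n z<k
... | inj₁ 1+z<k = inj₁ (1+z<k , trans (cong (_% k) (+-comm z 1)) (m<n⇒m%n≡m 1+z<k))
... | inj₂ 1+z≡k = inj₂ (1+z≡k , trans (cong (_% k) (trans (+-comm z 1) 1+z≡k)) (n%n≡0 k))

+1-mod-injective : ∀ k .{{_ : NonZero k}} {x y} → x < k → y < k → (x + 1) % k ≡ (y + 1) % k → x ≡ y
+1-mod-injective k x<k y<k eq with +1-mod k x<k | +1-mod k y<k
... | inj₁ (_ , p) | inj₁ (_ , q) = suc-injective (trans (sym p) (trans eq q))
... | inj₁ (_ , p) | inj₂ (_ , q) = ⊥-elim (0≢1+n (trans (sym q) (trans (sym eq) p)))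
... | inj₂ (_ , p) | inj₁ (_ , q) = ⊥-elim (0≢1+n (trans (sym p) (trans eq q)))
... | inj₂ (p , _) | inj₂ (q , _) = suc-injective (trans p (sym q))

+1-mod-moves : ∀ k .{{_ : NonZero k}} {z} → 2 ≤ k → z < k → (z + 1) % k ≢ z
+1-mod-moves k 2≤k z<k eq with +1-mod k z<k
... | inj₁ (_ , p) = 1+n≢n (trans (sym p) eq)
... | inj₂ (refl , p) with trans (sym eq) p
...   | refl with 2≤k
...     | s≤s ()

-- For k ≥ 3 adding two (one step at a time) modulo k moves every residue:
-- if neither step wraps we gain 2, and a wrap at either step forces k = 2.
+2-mod-moves : ∀ k .{{_ : NonZero k}} {z} → 3 ≤ k → z < k → ((z + 1) % k + 1) % k ≢ z
+2-mod-moves k {z} 3≤k z<k eq with +1-mod k z<k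
... | inj₁ (1+z<k , p) with +1-mod k 1+z<k
...   | inj₁ (_ , q) = m≢1+n+m z (sym (trans (sym q) (trans (cong (λ y → (y + 1) % k) (sym p)) eq)))
...   | inj₂ (refl , q) with trans (sym eq) (trans (cong (λ y → (y + 1) % k) p) q)
...     | refl with 3≤k
...       | s≤s (s≤s ())
+2-mod-moves k {z} 3≤k z<k eq | inj₂ (refl , p)
  with trans (sym (m<n⇒m%n≡m (<⇒≤ 3≤k))) (trans (cong (λ y → (y + 1) % k) (sym p)) eq)
... | refl with 3≤k
...   | s≤s (s≤s ())

module _ {k : ℕ} .{{_ : NonZero k}} where

  next : Fin k → Fin k
  next x = fromℕ< (m%n<n (toℕ x + 1) k)

  toℕ-next : ∀ x → toℕ (next x) ≡ (toℕ x + 1) % k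
  toℕ-next x = toℕ-fromℕ< (m%n<n (toℕ x + 1) k)

  cycle-edge : ∀ {x y} → Cycle k x y → y ≡ next x ⊎ x ≡ next y
  cycle-edge {x} {y} (inj₁ y≡x+1) = inj₁ (toℕ-injective (trans y≡x+1 (sym (toℕ-next x))))
  cycle-edge {x} {y} (inj₂ x≡y+1) = inj₂ (toℕ-injective (trans x≡y+1 (sym (toℕ-next y))))

  edge-to-next : ∀ x → Cycle k x (next x)
  edge-to-next x = inj₁ (toℕ-next x)

  edge-from-next : ∀ y → Cycle k (next y) y
  edge-from-next y = inj₂ (toℕ-next y)

  next-injective : ∀ {x y} → next x ≡ next y → x ≡ y
  next-injective {x} {y} eq = toℕ-injective (+1-mod-injective k (toℕ<n x) (toℕ<n y) eq′)
    where eq′ = trans (sym (toℕ-next x)) (trans (cong toℕ eq) (toℕ-next y))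

  next-moves : 2 ≤ k → ∀ x → next x ≢ x
  next-moves 2≤k x eq = +1-mod-moves k 2≤k (toℕ<n x) (trans (sym (toℕ-next x)) (cong toℕ eq))

  next²-moves : 3 ≤ k → ∀ x → next (next x) ≢ x
  next²-moves 3≤k x eq = +2-mod-moves k 3≤k (toℕ<n x) (begin
    ((toℕ x + 1) % k + 1) % k ≡⟨ cong (λ y → (y + 1) % k) (toℕ-next x) ⟨
    (toℕ (next x) + 1) % k   ≡⟨ toℕ-next (next x) ⟨
    toℕ (next (next x))      ≡⟨ cong toℕ eq ⟩
    toℕ x                    ∎)
    where open ≡-Reasoning

  cycle-loopless : 2 ≤ k → Loopless (Cycle k)
  cycle-loopless 2≤k {x} e with cycle-edge e
  ... | inj₁ x≡next-x = next-moves 2≤k x (sym x≡next-x)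
  ... | inj₂ x≡next-x = next-moves 2≤k x (sym x≡next-x)

module Covering {m k : ℕ} .{{_ : NonZero m}} .{{_ : NonZero k}} (k∣m : k ∣ m) where

  reduce : Fin m → Fin k
  reduce x = fromℕ< (m%n<n (toℕ x) k)

  reduce-next : ∀ x → reduce (next x) ≡ next (reduce x)
  reduce-next x = toℕ-injective (begin
    toℕ (reduce (next x))          ≡⟨ toℕ-fromℕ< (m%n<n (toℕ (next x)) k) ⟩
    toℕ (next x) % k               ≡⟨ cong (_% k) (toℕ-next x) ⟩
    (toℕ x + 1) % m % k            ≡⟨ m∣n⇒o%n%m≡o%m k m (toℕ x + 1) k∣m ⟩
    (toℕ x + 1) % k                ≡⟨ %-distribˡ-+ (toℕ x) 1 k ⟩
    (toℕ x % k + 1 % k) % k        ≡⟨ cong (λ y → (y + 1 % k) % k) (m%n%n≡m%n (toℕ x) k) ⟨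
    (toℕ x % k % k + 1 % k) % k    ≡⟨ %-distribˡ-+ (toℕ x % k) 1 k ⟨
    (toℕ x % k + 1) % k            ≡⟨ cong (λ y → (y + 1) % k) (toℕ-fromℕ< (m%n<n (toℕ x) k)) ⟨
    (toℕ (reduce x) + 1) % k       ≡⟨ toℕ-next (reduce x) ⟨
    toℕ (next (reduce x))          ∎)
    where open ≡-Reasoning

  reduce-homomorphism : Homomorphism (Cycle m) (Cycle k) reduce
  reduce-homomorphism {x} {y} e with cycle-edge e
  ... | inj₁ refl = subst (Cycle k (reduce x)) (sym (reduce-next x)) (edge-to-next (reduce x))
  ... | inj₂ refl = subst (λ z → Cycle k z (reduce y)) (sym (reduce-next y)) (edge-from-next (reduce y))

  twice-reduce-next : ∀ x → reduce (next (next x)) ≡ next (next (reduce x))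
  twice-reduce-next x = trans (reduce-next (next x)) (cong next (reduce-next x))

  -- Two steps in the same direction cannot return to the same residue mod k
  -- (k ≥ 3), and two steps in opposite directions retrace the same edge.
  reduce-locallyInjective : 3 ≤ k → LocallyInjective (Cycle m) reduce
  reduce-locallyInjective 3≤k e₁ e₂ eq with cycle-edge e₁ | cycle-edge e₂
  ... | inj₁ refl | inj₁ refl =
    ⊥-elim (next²-moves 3≤k _ (trans (sym (twice-reduce-next _)) (sym eq)))
  ... | inj₁ refl | inj₂ w≡next-v = next-injective w≡next-v
  ... | inj₂ refl | inj₁ refl = refl
  ... | inj₂ refl | inj₂ refl =
    ⊥-elim (next²-moves 3≤k _ (trans (sym (twice-reduce-next _)) eq))

lift-torus-colouring : ∀ {m n k l q} .{{_ : NonZero m}} .{{_ : NonZero n}} .{{_ : NonZero k}} .{{_ : NonZero l}} →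
                       k ∣ m → l ∣ n → 3 ≤ k → 3 ≤ l →
                       ProperColouring (Square (Cycle k □ Cycle l)) q →
                       ProperColouring (Square (Cycle m □ Cycle n)) q
lift-torus-colouring {m} {n} {k} {l} k∣m l∣n 3≤k 3≤l =
  pullback {G = Square (Cycle m □ Cycle n)} square-cover
  where
  open Covering k∣m renaming (reduce to reduceₘ; reduce-homomorphism to homₘ; reduce-locallyInjective to locInjₘ)
  open Covering l∣n renaming (reduce to reduceₙ; reduce-homomorphism to homₙ; reduce-locallyInjective to locInjₙ)

  Cₖ-loopless : Loopless (Cycle k)
  Cₖ-loopless = cycle-loopless (<⇒≤ 3≤k)

  Cₗ-loopless : Loopless (Cycle l)
  Cₗ-loopless = cycle-loopless (<⇒≤ 3≤l)

  cover : Homomorphism (Cycle m □ Cycle n) (Cycle k □ Cycle l) (reduceₘ ⊗ reduceₙ)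
  cover = □-homomorphism {G = Cycle m} {G′ = Cycle n} {H = Cycle k} {H′ = Cycle l} homₘ homₙ

  cover-locallyInjective : LocallyInjective (Cycle m □ Cycle n) (reduceₘ ⊗ reduceₙ)
  cover-locallyInjective = □-locallyInjective {G = Cycle m} {G′ = Cycle n} {H = Cycle k} {H′ = Cycle l}
    homₘ homₙ Cₖ-loopless Cₗ-loopless (locInjₘ 3≤k) (locInjₙ 3≤l)

  square-cover : Homomorphism (Square (Cycle m □ Cycle n)) (Square (Cycle k □ Cycle l)) (reduceₘ ⊗ reduceₙ)
  square-cover = square-homomorphism {G = Cycle m □ Cycle n} {H = Cycle k □ Cycle l}
    cover (□-loopless {G = Cycle k} {G′ = Cycle l} Cₖ-loopless Cₗ-loopless) cover-locallyInjective

module Torus {k l q : ℕ} .{{_ : NonZero k}} .{{_ : NonZero l}} (c : Fin k × Fin l → Fin q) where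

  -- The constraints a proper colouring of (C_k □ C_l)² must satisfy around the
  -- cell with corner (a , b): the two edges, the two straight walks of length
  -- two, and the two diagonals of the unit square leaving (a , b).
  record CellConstraints (a : Fin k) (b : Fin l) : Set where
    field
      row          : c (a , b) ≢ c (next a , b)
      column       : c (a , b) ≢ c (a , next b)
      row²         : c (a , b) ≢ c (next (next a) , b)
      column²      : c (a , b) ≢ c (a , next (next b))
      diagonal     : c (a , b) ≢ c (next a , next b)
      antidiagonal : c (next a , b) ≢ c (a , next b)

  cellConstraints? : ∀ a b → Dec (CellConstraints a b)
  cellConstraints? a b =
    map′ (λ (r , s , t , u , v , w) → record
           { row = r ; column = s ; row² = t ; column² = u ; diagonal = v ; antidiagonal = w })
         (λ cc → let open CellConstraints cc in row , column , row² , column² , diagonal , antidiagonal)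
         (distinct? _ _ ×-dec distinct? _ _ ×-dec distinct? _ _ ×-dec
          distinct? _ _ ×-dec distinct? _ _ ×-dec distinct? _ _)
    where
    distinct? : (x y : Fin q) → Dec (x ≢ y)
    distinct? x y = ¬? (x ≟ y)

  module _ (cells : ∀ a b → CellConstraints a b) where
    open CellConstraints

    row-edge : ∀ {x y b} → Cycle k x y → c (x , b) ≢ c (y , b)
    row-edge {x} {y} {b} e with cycle-edge e
    ... | inj₁ refl = row (cells x b)
    ... | inj₂ refl = ≢-sym (row (cells y b))

    column-edge : ∀ {a x y} → Cycle l x y → c (a , x) ≢ c (a , y)
    column-edge {a} {x} {y} e with cycle-edge e
    ... | inj₁ refl = column (cells a x)
    ... | inj₂ refl = ≢-sym (column (cells a y))

    -- A walk x ~ w ~ y in C_k with x ≠ y goes twice in the same direction.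
    row-walk : ∀ {x w y b} → Cycle k x w → Cycle k w y → x ≢ y → c (x , b) ≢ c (y , b)
    row-walk {x} {y = y} {b} e₁ e₂ x≢y with cycle-edge e₁ | cycle-edge e₂
    ... | inj₁ refl | inj₁ refl = row² (cells x b)
    ... | inj₁ refl | inj₂ eq   = ⊥-elim (x≢y (next-injective eq))
    ... | inj₂ refl | inj₁ refl = ⊥-elim (x≢y refl)
    ... | inj₂ refl | inj₂ refl = ≢-sym (row² (cells y b))

    column-walk : ∀ {a x w y} → Cycle l x w → Cycle l w y → x ≢ y → c (a , x) ≢ c (a , y)
    column-walk {a} {x} {y = y} e₁ e₂ x≢y with cycle-edge e₁ | cycle-edge e₂
    ... | inj₁ refl | inj₁ refl = column² (cells a x)
    ... | inj₁ refl | inj₂ eq   = ⊥-elim (x≢y (next-injective eq))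
    ... | inj₂ refl | inj₁ refl = ⊥-elim (x≢y refl)
    ... | inj₂ refl | inj₂ refl = ≢-sym (column² (cells a y))

    -- A walk turning a corner joins opposite corners of a unit square.
    corner-walk : ∀ {x a b y} → Cycle k x a → Cycle l b y → c (x , b) ≢ c (a , y)
    corner-walk {x} {a} {b} {y} e₁ e₂ with cycle-edge e₁ | cycle-edge e₂
    ... | inj₁ refl | inj₁ refl = diagonal (cells x b)
    ... | inj₁ refl | inj₂ refl = ≢-sym (antidiagonal (cells x y))
    ... | inj₂ refl | inj₁ refl = antidiagonal (cells a b)
    ... | inj₂ refl | inj₂ refl = ≢-sym (diagonal (cells a y))

    square-proper : ∀ u v → Square (Cycle k □ Cycle l) u v → c u ≢ c v
    square-proper _ _ (_ , inj₁ (inj₁ (e , refl))) = row-edge e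
    square-proper _ _ (_ , inj₁ (inj₂ (refl , e))) = column-edge e
    square-proper _ _ (u≢v , inj₂ (_ , inj₁ (e₁ , refl) , inj₁ (e₂ , refl))) =
      row-walk e₁ e₂ (u≢v ∘ cong (_, _))
    square-proper _ _ (u≢v , inj₂ (_ , inj₂ (refl , e₁) , inj₂ (refl , e₂))) =
      column-walk e₁ e₂ (u≢v ∘ cong (_ ,_))
    square-proper _ _ (_ , inj₂ (_ , inj₁ (e₁ , refl) , inj₂ (refl , e₂))) = corner-walk e₁ e₂
    square-proper _ _ (_ , inj₂ (_ , inj₂ (refl , e₁) , inj₁ (e₂ , refl))) = corner-walk e₂ e₁

ColourTable : Set
ColourTable = Vec (Vec (Fin 6) 11) 11

-- Row a, column b holds the colour of the vertex (a , b) of C₁₁ □ C₁₁.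
-- Numerals in this module denote elements of Fin 6.
module Table where
  open import Agda.Builtin.FromNat using (fromNat)

  instance
    finLiterals : ∀ {n} → Number (Fin n)
    finLiterals {n} = Fin.number n
    -- discharges the side condition "literal < 6" once it has computed to ⊤
    unit : ⊤
    unit = tt

  table : ColourTable
  table =
      ( 0 ∷ 1 ∷ 2 ∷ 0 ∷ 1 ∷ 2 ∷ 0 ∷ 1 ∷ 2 ∷ 3 ∷ 4 ∷ [] )
      ∷ ( 2 ∷ 3 ∷ 4 ∷ 5 ∷ 3 ∷ 4 ∷ 5 ∷ 3 ∷ 0 ∷ 5 ∷ 1 ∷ [] )
      ∷ ( 4 ∷ 0 ∷ 1 ∷ 2 ∷ 0 ∷ 1 ∷ 2 ∷ 4 ∷ 1 ∷ 2 ∷ 3 ∷ [] )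
      ∷ ( 1 ∷ 2 ∷ 3 ∷ 4 ∷ 5 ∷ 3 ∷ 0 ∷ 5 ∷ 3 ∷ 4 ∷ 0 ∷ [] )
      ∷ ( 3 ∷ 4 ∷ 5 ∷ 0 ∷ 2 ∷ 4 ∷ 1 ∷ 2 ∷ 0 ∷ 1 ∷ 2 ∷ [] )
      ∷ ( 0 ∷ 1 ∷ 2 ∷ 3 ∷ 1 ∷ 5 ∷ 3 ∷ 4 ∷ 5 ∷ 3 ∷ 4 ∷ [] )
      ∷ ( 5 ∷ 3 ∷ 0 ∷ 5 ∷ 4 ∷ 2 ∷ 0 ∷ 1 ∷ 2 ∷ 0 ∷ 1 ∷ [] )
      ∷ ( 2 ∷ 4 ∷ 1 ∷ 2 ∷ 0 ∷ 1 ∷ 5 ∷ 3 ∷ 4 ∷ 5 ∷ 3 ∷ [] )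
      ∷ ( 0 ∷ 5 ∷ 3 ∷ 4 ∷ 5 ∷ 3 ∷ 4 ∷ 0 ∷ 1 ∷ 2 ∷ 4 ∷ [] )
      ∷ ( 1 ∷ 2 ∷ 0 ∷ 1 ∷ 2 ∷ 0 ∷ 1 ∷ 2 ∷ 3 ∷ 0 ∷ 5 ∷ [] )
      ∷ ( 3 ∷ 4 ∷ 5 ∷ 3 ∷ 4 ∷ 5 ∷ 3 ∷ 4 ∷ 5 ∷ 1 ∷ 2 ∷ [] )
    ∷ []

colour₁₁ : Fin 11 × Fin 11 → Fin 6
colour₁₁ (a , b) = lookup (lookup Table.table a) b

colouring₁₁ : ProperColouring (Square (Cycle 11 □ Cycle 11)) 6
colouring₁₁ = colour₁₁ , square-proper cells
  where
  open Torus colour₁₁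
  cells : ∀ a b → CellConstraints a b
  cells = toWitness {a? = all? (λ a → all? (cellConstraints? a))} _

corollary5 : (m n : ℕ) .{{_ : NonZero m}} .{{_ : NonZero n}} → m ≥ 3 → n ≥ 3 → m % 11 ≡ 0 → n % 11 ≡ 0 → χ≤ (Square (Cycle m □ Cycle n)) 6
corollary5 m n _ _ m%11≡0 n%11≡0 =
  lift-torus-colouring (m%n≡0⇒n∣m m 11 m%11≡0) (m%n≡0⇒n∣m n 11 n%11≡0) 3≤11 3≤11 colouring₁₁
  where
  3≤11 : 3 ≤ 11
  3≤11 = s≤s (s≤s (s≤s z≤n))
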